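{- Let $G=(V,E)$ be a graph, $u,v\in V$ distinct, and let $\mathcal{H}=\{H_1,\dots,H_k\}$ ($k\ge2$) be a $uv$-compatible family with $H_i\cap H_j=\{u,v\}$ for all $1\le i<j\le k$ and $|H_k|\ge4$. Then $\mathcal{H}'=\{H_1,\dots,H_{k-2},H_{k-1}\cup H_k\}$ is a $uv$-compatible family with $\mathrm{cov}(\mathcal{H})\subseteq\mathrm{cov}(\mathcal{H}')$ and $\mathrm{val}(\mathcal{H}')\le\mathrm{val}(\mathcal{H})+1$, with equality only if $|H_{k-1}|=3$. Furthermore, if $G$ is $uv$-sparse, $\mathcal{H}$ is tight and $|H_{k-1}|\ge4$, then $\mathcal{H}'$ is tight.
   Context: Graphs are finite and simple. $i(X)$ counts edges with both ends in $X\subseteq V$; for a family $\mathcal{S}=\{S_1,\dots,S_k\}$, $i(\mathcal{S})$ counts edges with both ends in some $S_j$ and $\mathrm{cov}(\mathcal{S})=\{(x,y):x,y\in V,\{x,y\}\subseteq S_j\text{ for some }j\}$. For nonempty $H\subseteq V$, $\mathrm{val}(H)=2|H|-t_H$ with $t_H=4$ if $H=\{u,v\}$, $t_H=3$ if $H\ne\{u,v\}$ and $|H|\in\{2,3\}$, $t_H=2$ otherwise. A family is $uv$-compatible if each member contains $u,v$ and has size at least 3; $\mathrm{val}(\mathcal{H})=\sum_j\mathrm{val}(H_j)-2(k-1)$. $G$ is $uv$-sparse if $i(H)\le\mathrm{val}(H)$ for all $H\subseteq V$ with $|H|\ge2$ and $i(\mathcal{H})\le\mathrm{val}(\mathcal{H})$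 for all $uv$-compatible $\mathcal{H}$; $\mathcal{H}$ is tight if $i(\mathcal{H})=\mathrm{val}(\mathcal{H})$. -}

module Defs where

open import Data.Bool using (Bool; true; false; _∧_; if_then_else_)
open import Data.Nat as ℕ using (ℕ; zero; suc)
open import Data.Integer as ℤ using (ℤ; +_; _-_)
open import Data.Fin using (Fin; _<?_)
open import Data.Fin.Subset using (Subset; _∈_; ∣_∣; ⁅_⁆; _∪_)
open import Data.Fin.Subset.Properties using (_∈?_)
open import Data.Bool.Properties renaming (_≟_ to _≟ᵇ_) using ()
open import Data.Vec using (lookup)
open import Data.Vec.Properties using (≡-dec)
open import Data.List using (List; []; _∷_; length; allFin; concatMap; map; filterᵇ)
open import Data.List.Relation.Unary.Any using (Any)
open import Data.List.Relation.Unary.All using (All)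
open import Data.Product using (_×_; _,_)
open import Relation.Nullary.Decidable using (⌊_⌋; yes; no)
open import Relation.Binary.PropositionalEquality using (_≡_)

record Graph (n : ℕ) : Set where
  field
    adj    : Fin n → Fin n → Bool
    sym    : ∀ x y → adj x y ≡ adj y x
    irrefl : ∀ x → adj x x ≡ false
open Graph public

-- all ordered pairs (x , y) of vertices with x < y (i.e. unordered pairs)
pairs : (n : ℕ) → List (Fin n × Fin n)
pairs n = filterᵇ (λ { (x , y) → ⌊ x <? y ⌋ })
            (concatMap (λ x → map (x ,_) (allFin n)) (allFin n))

both : ∀ {n} → Subset n → Fin n → Fin n → Bool
both S x y = lookup S x ∧ lookup S y

anyBoth : ∀ {n} → List (Subset n) → Fin n → Fin n → Bool
anyBoth []       x y = false
anyBoth (S ∷ Ss) x y = if both S x y then true else anyBoth Ss x y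

iSet : ∀ {n} → Graph n → Subset n → ℕ
iSet {n} G X = length (filterᵇ (λ { (x , y) → adj G x y ∧ both X x y }) (pairs n))

iFam : ∀ {n} → Graph n → List (Subset n) → ℕ
iFam {n} G Ss = length (filterᵇ (λ { (x , y) → adj G x y ∧ anyBoth Ss x y }) (pairs n))

Cov : ∀ {n} → List (Subset n) → Fin n → Fin n → Set
Cov Ss x y = Any (λ S → x ∈ S × y ∈ S) Ss

_⊆cov_ : ∀ {n} → List (Subset n) → List (Subset n) → Set
_⊆cov_ {n} Ss Ts = ∀ (x y : Fin n) → Cov Ss x y → Cov Ts x y

tH : ∀ {n} → Fin n → Fin n → Subset n → ℕ
tH u v H with ≡-dec _≟ᵇ_ H (⁅ u ⁆ ∪ ⁅ v ⁆)
... | yes _ = 4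
... | no  _ with ∣ H ∣
...   | 2 = 3
...   | 3 = 3
...   | _ = 2

val : ∀ {n} → Fin n → Fin n → Subset n → ℤ
val u v H = + (2 ℕ.* ∣ H ∣) - + tH u v H

sumℤ : List ℤ → ℤ
sumℤ []       = + 0
sumℤ (a ∷ as) = a ℤ.+ sumℤ as

valFam : ∀ {n} → Fin n → Fin n → List (Subset n) → ℤ
valFam u v Hs = sumℤ (map (val u v) Hs) - (+ 2 ℤ.* (+ length Hs - + 1))

Compatible : ∀ {n} → Fin n → Fin n → List (Subset n) → Set
Compatible u v Hs = All (λ H → u ∈ H × v ∈ H × 3 ℕ.≤ ∣ H ∣) Hs

Sparse : ∀ {n} → Graph n → Fin n → Fin n → Set
Sparse {n} G u v =
  (∀ (H : Subset n) → 2 ℕ.≤ ∣ H ∣ → + iSet G H ℤ.≤ val u v H)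
  × (∀ (Hs : List (Subset n)) → Compatible u v Hs → + iFam G Hs ℤ.≤ valFam u v Hs)

Tight : ∀ {n} → Graph n → Fin n → Fin n → List (Subset n) → Set
Tight G u v Hs = + iFam G Hs ≡ valFam u v Hs

-- Merging the last two members A and B of the family into A ∪ B removes one
-- member, which adds 2 to val(𝓗), while |A ∪ B| = |A| + |B| − 2 because
-- A ∩ B = {u, v}.  As |B| ≥ 4 and |A ∪ B| ≥ 4, the only other change is that
-- t_A is replaced by 2, so val(𝓗') = val(𝓗) + (t_A − 2), and t_A − 2 is 1 or 0
-- according as |A| = 3 or |A| ≥ 4.  Since 𝓗' covers every pair covered by 𝓗,
-- i(𝓗) ≤ i(𝓗'); under uv-sparsity i(𝓗') ≤ val(𝓗') = val(𝓗) = i(𝓗) when |A| ≥ 4.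
module Submission where

open import Defs hiding (sym)
open import Data.Bool using (Bool; true; false; T; _∧_)
open import Data.Empty using (⊥-elim)
open import Data.Nat as ℕ using (ℕ; suc; _≤_; z≤n; s≤s)
import Data.Nat.Properties as ℕP
open import Data.Integer as ℤ using (ℤ; +_; _-_)
import Data.Integer.Properties as ℤP
open import Data.Integer.Tactic.RingSolver using (solve-∀)
open import Algebra.Properties.AbelianGroup ℤP.+-0-abelianGroup using (∙-cancelˡ)
open import Data.Fin using (Fin; zero; suc)
open import Data.Fin.Subset using (Subset; ∣_∣; ⁅_⁆; _∪_; _∩_)
open import Data.Fin.Subset.Properties
  using (∪-identityˡ; ∪-identityʳ; ∣⁅x⁆∣≡1; x∈p∪q⁺; ∣p∣≤∣p∪q∣; ∣q∣≤∣p∪q∣)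
open import Data.Vec using ([]; _∷_; lookup)
open import Data.Vec.Properties using (≡-dec; []=⇒lookup; lookup⇒[]=)
open import Data.Bool.Properties renaming (_≟_ to _≟ᵇ_) using ()
open import Data.List using (List; []; _∷_; _++_; length; map; filterᵇ)
open import Data.List.Properties using (map-++; length-++)
open import Data.List.Relation.Unary.All as All using (_∷_; [])
import Data.List.Relation.Unary.All.Properties as AllP
open import Data.List.Relation.Unary.AllPairs using (AllPairs; _∷_)
open import Data.List.Relation.Unary.Any using (here; there)
open import Data.Product using (_×_; _,_; proj₂)
open import Data.Sum using (inj₁; inj₂)
open import Data.Unit using (tt)
open import Relation.Nullary using (yes; no)
open import Relation.Binary.PropositionalEquality
  using (_≡_; _≢_; refl; sym; trans; cong; cong₂; subst; module ≡-Reasoning)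

∣p∪q∣+∣p∩q∣≡∣p∣+∣q∣ : ∀ {n} (p q : Subset n) → ∣ p ∪ q ∣ ℕ.+ ∣ p ∩ q ∣ ≡ ∣ p ∣ ℕ.+ ∣ q ∣
∣p∪q∣+∣p∩q∣≡∣p∣+∣q∣ []          []          = refl
∣p∪q∣+∣p∩q∣≡∣p∣+∣q∣ (true ∷ p)  (true ∷ q)  =
  cong suc (trans (ℕP.+-suc _ _) (trans (cong suc (∣p∪q∣+∣p∩q∣≡∣p∣+∣q∣ p q)) (sym (ℕP.+-suc _ _))))
∣p∪q∣+∣p∩q∣≡∣p∣+∣q∣ (true ∷ p)  (false ∷ q) = cong suc (∣p∪q∣+∣p∩q∣≡∣p∣+∣q∣ p q)
∣p∪q∣+∣p∩q∣≡∣p∣+∣q∣ (false ∷ p) (true ∷ q)  = trans (cong suc (∣p∪q∣+∣p∩q∣≡∣p∣+∣q∣ p q)) (sym (ℕP.+-suc _ _))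
∣p∪q∣+∣p∩q∣≡∣p∣+∣q∣ (false ∷ p) (false ∷ q) = ∣p∪q∣+∣p∩q∣≡∣p∣+∣q∣ p q

∣⁅x⁆∪⁅y⁆∣≤2 : ∀ {n} (x y : Fin n) → ∣ ⁅ x ⁆ ∪ ⁅ y ⁆ ∣ ≤ 2
∣⁅x⁆∪⁅y⁆∣≤2 x y = ℕP.≤-trans (ℕP.m≤m+n _ _) (ℕP.≤-reflexive
  (trans (∣p∪q∣+∣p∩q∣≡∣p∣+∣q∣ ⁅ x ⁆ ⁅ y ⁆) (cong₂ ℕ._+_ (∣⁅x⁆∣≡1 x) (∣⁅x⁆∣≡1 y))))

∣⁅x⁆∪⁅y⁆∣≡2 : ∀ {n} {x y : Fin n} → x ≢ y → ∣ ⁅ x ⁆ ∪ ⁅ y ⁆ ∣ ≡ 2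
∣⁅x⁆∪⁅y⁆∣≡2 {x = zero}  {zero}  x≢y = ⊥-elim (x≢y refl)
∣⁅x⁆∪⁅y⁆∣≡2 {x = zero}  {suc y} _   rewrite ∪-identityˡ ⁅ y ⁆ | ∣⁅x⁆∣≡1 y = refl
∣⁅x⁆∪⁅y⁆∣≡2 {x = suc x} {zero}  _   rewrite ∪-identityʳ ⁅ x ⁆ | ∣⁅x⁆∣≡1 x = refl
∣⁅x⁆∪⁅y⁆∣≡2 {x = suc x} {suc y} x≢y = ∣⁅x⁆∪⁅y⁆∣≡2 (λ x≡y → x≢y (cong suc x≡y))

module _ {n : ℕ} (u v : Fin n) where

  tH-size3 : (H : Subset n) → ∣ H ∣ ≡ 3 → tH u v H ≡ 3
  tH-size3 H ∣H∣≡3 with ≡-dec _≟ᵇ_ H (⁅ u ⁆ ∪ ⁅ v ⁆)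
  ... | yes refl = ⊥-elim (ℕP.≤⇒≯ (∣⁅x⁆∪⁅y⁆∣≤2 u v) (ℕP.≤-reflexive (sym ∣H∣≡3)))
  ... | no _ rewrite ∣H∣≡3 = refl

  tH-large : (H : Subset n) → 4 ≤ ∣ H ∣ → tH u v H ≡ 2
  tH-large H 4≤∣H∣ with ≡-dec _≟ᵇ_ H (⁅ u ⁆ ∪ ⁅ v ⁆)
  ... | yes refl = ⊥-elim (ℕP.≤⇒≯ (∣⁅x⁆∪⁅y⁆∣≤2 u v) (ℕP.<⇒≤ 4≤∣H∣))
  ... | no _ with ∣ H ∣ | 4≤∣H∣
  ...   | suc (suc (suc (suc _))) | _                    = refl
  ...   | 1                       | s≤s ()
  ...   | 2                       | s≤s (s≤s ())
  ...   | 3                       | s≤s (s≤s (s≤s ()))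

  -- The amount by which val H falls short of 2|H| − 2, the value for |H| ≥ 4.
  excess : Subset n → ℤ
  excess H = + tH u v H - + 2

  excess-large : (H : Subset n) → 4 ≤ ∣ H ∣ → excess H ≡ + 0
  excess-large H 4≤∣H∣ = cong (λ t → + t - + 2) (tH-large H 4≤∣H∣)

  excess≤1 : (H : Subset n) → 3 ≤ ∣ H ∣ → excess H ℤ.≤ + 1
  excess≤1 H 3≤∣H∣ with ℕP.m≤n⇒m<n∨m≡n 3≤∣H∣
  ... | inj₁ 4≤∣H∣ = ℤP.≤-trans (ℤP.≤-reflexive (excess-large H 4≤∣H∣)) (ℤ.+≤+ z≤n)
  ... | inj₂ 3≡∣H∣ = ℤP.≤-reflexive (cong (λ t → + t - + 2) (tH-size3 H (sym 3≡∣H∣)))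

  excess≡1⇒∣H∣≡3 : (H : Subset n) → 3 ≤ ∣ H ∣ → excess H ≡ + 1 → ∣ H ∣ ≡ 3
  excess≡1⇒∣H∣≡3 H 3≤∣H∣ excess≡1 with ℕP.m≤n⇒m<n∨m≡n 3≤∣H∣
  ... | inj₁ 4≤∣H∣ with () ← trans (sym (excess-large H 4≤∣H∣)) excess≡1
  ... | inj₂ 3≡∣H∣ = sym 3≡∣H∣

  val-∪ : u ≢ v → (A B : Subset n) → A ∩ B ≡ ⁅ u ⁆ ∪ ⁅ v ⁆ → 4 ≤ ∣ B ∣ →
    val u v (A ∪ B) ≡ val u v A ℤ.+ val u v B ℤ.+ excess A - + 2
  val-∪ u≢v A B A∩B≡uv 4≤∣B∣ = begin
    + (2 ℕ.* ∣ A ∪ B ∣) - + tH u v (A ∪ B)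
      ≡⟨ cong (λ t → + (2 ℕ.* ∣ A ∪ B ∣) - + t) (tH-large (A ∪ B) (ℕP.≤-trans 4≤∣B∣ (∣q∣≤∣p∪q∣ A B))) ⟩
    X - + 2
      ≡⟨ shift X ⟩
    (X ℤ.+ + 4) - + 6
      ≡⟨ cong (_- + 6) doubled ⟩
    (Y ℤ.+ Z) - + 6
      ≡⟨ regroup Y Z (+ tH u v A) ⟩
    (Y - + tH u v A) ℤ.+ (Z - + 2) ℤ.+ excess A - + 2
      ≡⟨ cong (λ t → (Y - + tH u v A) ℤ.+ (Z - + t) ℤ.+ excess A - + 2) (sym (tH-large B 4≤∣B∣)) ⟩
    val u v A ℤ.+ val u v B ℤ.+ excess A - + 2 ∎
    where
    open ≡-Reasoning
    X = + (2 ℕ.* ∣ A ∪ B ∣)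
    Y = + (2 ℕ.* ∣ A ∣)
    Z = + (2 ℕ.* ∣ B ∣)
    shift : ∀ (x : ℤ) → x - + 2 ≡ (x ℤ.+ + 4) - + 6
    shift = solve-∀
    regroup : ∀ (y z t : ℤ) → (y ℤ.+ z) - + 6 ≡ (y - t) ℤ.+ (z - + 2) ℤ.+ (t - + 2) - + 2
    regroup = solve-∀
    ∣A∪B∣+2 : ∣ A ∪ B ∣ ℕ.+ 2 ≡ ∣ A ∣ ℕ.+ ∣ B ∣
    ∣A∪B∣+2 = trans (cong (∣ A ∪ B ∣ ℕ.+_) (sym (trans (cong ∣_∣ A∩B≡uv) (∣⁅x⁆∪⁅y⁆∣≡2 u≢v))))
                    (∣p∪q∣+∣p∩q∣≡∣p∣+∣q∣ A B)
    doubled : X ℤ.+ + 4 ≡ Y ℤ.+ Z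
    doubled = trans (sym (ℤP.pos-+ (2 ℕ.* ∣ A ∪ B ∣) 4)) (trans
      (cong +_ (trans (sym (ℕP.*-distribˡ-+ 2 ∣ A ∪ B ∣ 2))
                      (trans (cong (2 ℕ.*_) ∣A∪B∣+2) (ℕP.*-distribˡ-+ 2 ∣ A ∣ ∣ B ∣))))
      (ℤP.pos-+ (2 ℕ.* ∣ A ∣) (2 ℕ.* ∣ B ∣)))

  sumℤ-++ : (xs ys : List ℤ) → sumℤ (xs ++ ys) ≡ sumℤ xs ℤ.+ sumℤ ys
  sumℤ-++ []       ys = sym (ℤP.+-identityˡ (sumℤ ys))
  sumℤ-++ (x ∷ xs) ys = trans (cong (λ s → x ℤ.+ s) (sumℤ-++ xs ys)) (sym (ℤP.+-assoc x (sumℤ xs) (sumℤ ys)))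

  valFam-++ : (Hs Ks : List (Subset n)) → valFam u v (Hs ++ Ks) ≡
    (sumℤ (map (val u v) Hs) ℤ.+ sumℤ (map (val u v) Ks)) - + 2 ℤ.* ((+ length Hs ℤ.+ + length Ks) - + 1)
  valFam-++ Hs Ks = cong₂ (λ s ℓ → s - + 2 ℤ.* (ℓ - + 1))
    (trans (cong sumℤ (map-++ (val u v) Hs Ks)) (sumℤ-++ (map (val u v) Hs) (map (val u v) Ks)))
    (trans (cong +_ (length-++ Hs)) (ℤP.pos-+ (length Hs) (length Ks)))

  -- One member fewer raises val(𝓗) by 2, which the "− 2" in the hypothesis absorbs.
  valFam-merge : (Hs : List (Subset n)) (A B C : Subset n) (d : ℤ) →
    val u v C ≡ val u v A ℤ.+ val u v B ℤ.+ d - + 2 →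
    valFam u v (Hs ++ C ∷ []) ≡ valFam u v (Hs ++ A ∷ B ∷ []) ℤ.+ d
  valFam-merge Hs A B C d valC = begin
    valFam u v (Hs ++ C ∷ [])
      ≡⟨ valFam-++ Hs (C ∷ []) ⟩
    (S ℤ.+ (val u v C ℤ.+ + 0)) - + 2 ℤ.* ((m ℤ.+ + 1) - + 1)
      ≡⟨ cong (λ c → (S ℤ.+ (c ℤ.+ + 0)) - + 2 ℤ.* ((m ℤ.+ + 1) - + 1)) valC ⟩
    (S ℤ.+ ((val u v A ℤ.+ val u v B ℤ.+ d - + 2) ℤ.+ + 0)) - + 2 ℤ.* ((m ℤ.+ + 1) - + 1)
      ≡⟨ regroup S m (val u v A) (val u v B) d ⟩
    (S ℤ.+ (val u v A ℤ.+ (val u v B ℤ.+ + 0))) - + 2 ℤ.* ((m ℤ.+ + 2) - + 1) ℤ.+ d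
      ≡⟨ cong (ℤ._+ d) (sym (valFam-++ Hs (A ∷ B ∷ []))) ⟩
    valFam u v (Hs ++ A ∷ B ∷ []) ℤ.+ d ∎
    where
    open ≡-Reasoning
    S = sumℤ (map (val u v) Hs)
    m = + length Hs
    regroup : ∀ (s m a b d : ℤ) →
      (s ℤ.+ ((a ℤ.+ b ℤ.+ d - + 2) ℤ.+ + 0)) - + 2 ℤ.* ((m ℤ.+ + 1) - + 1)
      ≡ (s ℤ.+ (a ℤ.+ (b ℤ.+ + 0))) - + 2 ℤ.* ((m ℤ.+ + 2) - + 1) ℤ.+ d
    regroup = solve-∀

  Compatible-merge : (Hs : List (Subset n)) (A B : Subset n) →
    Compatible u v (Hs ++ A ∷ B ∷ []) → Compatible u v (Hs ++ (A ∪ B) ∷ [])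
  Compatible-merge Hs A B compatible with AllP.++⁻ Hs compatible
  ... | compatibleHs , (u∈A , v∈A , 3≤∣A∣) ∷ _ = AllP.++⁺ compatibleHs
    ((x∈p∪q⁺ (inj₁ u∈A) , x∈p∪q⁺ (inj₁ v∈A) , ℕP.≤-trans 3≤∣A∣ (∣p∣≤∣p∪q∣ A B)) ∷ [])

module _ {n : ℕ} where

  Cov⇒anyBoth : (Ss : List (Subset n)) (x y : Fin n) → Cov Ss x y → T (anyBoth Ss x y)
  Cov⇒anyBoth (S ∷ Ss) x y (here (x∈S , y∈S)) rewrite []=⇒lookup x∈S | []=⇒lookup y∈S = tt
  Cov⇒anyBoth (S ∷ Ss) x y (there c) with both S x y
  ... | true  = tt
  ... | false = Cov⇒anyBoth Ss x y c

  anyBoth⇒Cov : (Ss : List (Subset n)) (x y : Fin n) → T (anyBoth Ss x y) → Cov Ss x y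
  anyBoth⇒Cov (S ∷ Ss) x y t with lookup S x in x∈S | lookup S y in y∈S
  ... | true  | true  = here (lookup⇒[]= x S x∈S , lookup⇒[]= y S y∈S)
  ... | true  | false = there (anyBoth⇒Cov Ss x y t)
  ... | false | _     = there (anyBoth⇒Cov Ss x y t)

  ⊆cov-++⁺ˡ : (Hs : List (Subset n)) {Ks Ls : List (Subset n)} → Ks ⊆cov Ls → (Hs ++ Ks) ⊆cov (Hs ++ Ls)
  ⊆cov-++⁺ˡ []       Ks⊆Ls = Ks⊆Ls
  ⊆cov-++⁺ˡ (H ∷ Hs) Ks⊆Ls x y (here p)  = here p
  ⊆cov-++⁺ˡ (H ∷ Hs) Ks⊆Ls x y (there c) = there (⊆cov-++⁺ˡ Hs Ks⊆Ls x y c)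

  pair⊆cov∪ : (A B : Subset n) → (A ∷ B ∷ []) ⊆cov ((A ∪ B) ∷ [])
  pair⊆cov∪ A B x y (here (x∈A , y∈A))         = here (x∈p∪q⁺ (inj₁ x∈A) , x∈p∪q⁺ (inj₁ y∈A))
  pair⊆cov∪ A B x y (there (here (x∈B , y∈B))) = here (x∈p∪q⁺ (inj₂ x∈B) , x∈p∪q⁺ (inj₂ y∈B))

length-filterᵇ-mono : ∀ {A : Set} {p q : A → Bool} → (∀ x → T (p x) → T (q x)) →
  (xs : List A) → length (filterᵇ p xs) ≤ length (filterᵇ q xs)
length-filterᵇ-mono         p⇒q []       = z≤n
length-filterᵇ-mono {p = p} {q} p⇒q (x ∷ xs) with p x | q x | p⇒q x
... | true  | true  | _   = s≤s (length-filterᵇ-mono p⇒q xs)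
... | true  | false | p⇒q = ⊥-elim (p⇒q tt)
... | false | true  | _   = ℕP.m≤n⇒m≤1+n (length-filterᵇ-mono p⇒q xs)
... | false | false | _   = length-filterᵇ-mono p⇒q xs

iFam-mono : ∀ {n} (G : Graph n) {Ks Ls : List (Subset n)} → Ks ⊆cov Ls → iFam G Ks ≤ iFam G Ls
iFam-mono {n} G {Ks} {Ls} Ks⊆Ls = length-filterᵇ-mono (λ { (x , y) → edge-mono x y }) (pairs n)
  where
  edge-mono : ∀ x y → T (adj G x y ∧ anyBoth Ks x y) → T (adj G x y ∧ anyBoth Ls x y)
  edge-mono x y t with adj G x y
  ... | true = Cov⇒anyBoth Ls x y (Ks⊆Ls x y (anyBoth⇒Cov Ks x y t))

Tight-⊆cov : ∀ {n} (G : Graph n) (u v : Fin n) {Ks Ls : List (Subset n)} →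
  Sparse G u v → Compatible u v Ls → Ks ⊆cov Ls → valFam u v Ls ≡ valFam u v Ks →
  Tight G u v Ks → Tight G u v Ls
Tight-⊆cov G u v {Ks} {Ls} (_ , sparseFam) compatible Ks⊆Ls val≡ tight =
  trans (ℤP.≤-antisym upper (ℤ.+≤+ (iFam-mono G Ks⊆Ls))) (trans tight (sym val≡))
  where
  upper : + iFam G Ls ℤ.≤ + iFam G Ks
  upper = ℤP.≤-trans (sparseFam Ls compatible) (ℤP.≤-reflexive (trans val≡ (sym tight)))

AllPairs-last-pair : ∀ {A : Set} {R : A → A → Set} (xs : List A) {x y : A} →
  AllPairs R (xs ++ x ∷ y ∷ []) → R x y
AllPairs-last-pair []       ((r ∷ []) ∷ _) = r
AllPairs-last-pair (_ ∷ xs) (_ ∷ rs)       = AllPairs-last-pair xs rs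

lemma3p3 : ∀ {n : ℕ} (G : Graph n) (u v : Fin n) → u ≢ v →
    (Hs : List (Subset n)) (A B : Subset n) →
    Compatible u v (Hs ++ A ∷ B ∷ []) →
    AllPairs (λ X Y → X ∩ Y ≡ ⁅ u ⁆ ∪ ⁅ v ⁆) (Hs ++ A ∷ B ∷ []) →
    4 ≤ ∣ B ∣ →
    Compatible u v (Hs ++ (A ∪ B) ∷ [])
    × (Hs ++ A ∷ B ∷ []) ⊆cov (Hs ++ (A ∪ B) ∷ [])
    × valFam u v (Hs ++ (A ∪ B) ∷ []) ℤ.≤ valFam u v (Hs ++ A ∷ B ∷ []) ℤ.+ + 1
    × (valFam u v (Hs ++ (A ∪ B) ∷ []) ≡ valFam u v (Hs ++ A ∷ B ∷ []) ℤ.+ + 1 → ∣ A ∣ ≡ 3)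
    × (Sparse G u v → Tight G u v (Hs ++ A ∷ B ∷ []) → 4 ≤ ∣ A ∣ →
         Tight G u v (Hs ++ (A ∪ B) ∷ []))
lemma3p3 G u v u≢v Hs A B compatible intersections 4≤∣B∣ =
    compatible′
  , covers
  , subst (ℤ._≤ old ℤ.+ + 1) (sym merged) (ℤP.+-monoʳ-≤ old (excess≤1 u v A 3≤∣A∣))
  , (λ merged≡old+1 → excess≡1⇒∣H∣≡3 u v A 3≤∣A∣
       (∙-cancelˡ old (excess u v A) (+ 1) (trans (sym merged) merged≡old+1)))
  , λ sparse tight 4≤∣A∣ → Tight-⊆cov G u v sparse compatible′ covers
       (trans merged (trans (cong (λ d → old ℤ.+ d) (excess-large u v A 4≤∣A∣)) (ℤP.+-identityʳ old))) tight
  where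
  old = valFam u v (Hs ++ A ∷ B ∷ [])
  3≤∣A∣ : 3 ≤ ∣ A ∣
  3≤∣A∣ = proj₂ (proj₂ (All.head (proj₂ (AllP.++⁻ Hs compatible))))
  compatible′ = Compatible-merge u v Hs A B compatible
  covers = ⊆cov-++⁺ˡ Hs (pair⊆cov∪ A B)
  merged : valFam u v (Hs ++ (A ∪ B) ∷ []) ≡ old ℤ.+ excess u v A
  merged = valFam-merge u v Hs A B (A ∪ B) (excess u v A)
             (val-∪ u v u≢v A B (AllPairs-last-pair Hs intersections) 4≤∣B∣)
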